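{- Let $C^\bullet=\bigoplus_{r\in\mathbb{Z}}C^r$ be a differential $\mathbb{Z}$-graded algebra over a ring $R$, with differential $\partial$, and let $n\geq 2$. Suppose that for every 1-cocycles $c_1,\dots,c_n\in C^1$ there is a defining system $(c_{ij})$ of size $n$ in $C^\bullet$ with $c_{ii}=c_i$ for $i=1,\dots,n$. Then for any two defining systems $(c_{ij}),(c'_{ij})$ of size $n$ with $[c_{ii}]=[c'_{ii}]$ in $H^1$ for $i=1,\dots,n$, one has $[\widetilde c_{1n}]=[\widetilde c'_{1n}]$ in $H^2$.
   Context: A differential $\mathbb{Z}$-graded algebra (DGA) over $R$ is a graded $R$-algebra $C^\bullet=\bigoplus_r C^r$ with homomorphisms $\partial^r\colon C^r\to C^{r+1}$ making it a complex and satisfying $\partial(ab)=\partial(a)b+(-1)^r a\partial(b)$ for $a\in C^r$. $H^i$ is its $i$-th cohomology group and $[c]$ the class of a cocycle $c$. For a family $c_{ij}\in C^1$ one sets $\widetilde c_{ij}=-\sum_{r=i}^{j-1}c_{ir}c_{r+1,j}\in C^2$. A defining system of size $n$ is a family $c_{ij}\in C^1$, $1\leq i\leq j\leq n$, $(i,j)\neq(1,n)$, such that $\widetilde c_{ij}=\partial c_{ij}$ for every such $(i,j)$; then each $c_{ii}$ is a 1-cocycle and $\widetilde c_{1n}$ is a 2-cocycle. -}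

module Defs where

open import Level using (Level; _⊔_) renaming (suc to lsuc)
open import Data.Nat as ℕ using (ℕ; zero; suc; _∸_; _≤_)
open import Data.Integer as ℤ using (ℤ; +_; ∣_∣) renaming (_+_ to _⊕_)
open import Data.Integer.Properties as ℤP using ()
open import Data.Product using (Σ; ∃; _×_; _,_)
open import Relation.Nullary using (¬_)
open import Relation.Binary.PropositionalEquality using (_≡_; subst; trans; cong; sym)
open import Algebra.Bundles using (CommutativeRing)
open import Algebra.Module.Bundles using (Module)

⟨_⟩ : ∀ {r ℓr m ℓm} {R : CommutativeRing r ℓr} → Module R m ℓm → Set m
⟨ M ⟩ = Module.Carrierᴹ M

deg-assoc : ∀ r s t → (r ⊕ s) ⊕ t ≡ r ⊕ (s ⊕ t)
deg-assoc = ℤP.+-assoc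

deg-left : ∀ r s → (r ⊕ + 1) ⊕ s ≡ (r ⊕ s) ⊕ + 1
deg-left r s = trans (ℤP.+-assoc r (+ 1) s)
                 (trans (cong (r ⊕_) (ℤP.+-comm (+ 1) s)) (sym (ℤP.+-assoc r s (+ 1))))

deg-right : ∀ r s → r ⊕ (s ⊕ + 1) ≡ (r ⊕ s) ⊕ + 1
deg-right r s = sym (ℤP.+-assoc r s (+ 1))

module _ {r ℓr m ℓm} {R : CommutativeRing r ℓr} (C : ℤ → Module R m ℓm) where

  cast : ∀ {p q} → p ≡ q → ⟨ C p ⟩ → ⟨ C q ⟩
  cast e x = subst (λ k → ⟨ C k ⟩) e x

  signℕ : ∀ {p} → ℕ → ⟨ C p ⟩ → ⟨ C p ⟩
  signℕ zero    x = x
  signℕ (suc k) x = Module.-ᴹ_ (C _) (signℕ k x)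

  -- multiplication by (-1)^p for p ∈ ℤ (on any degree d); (-1)^p = (-1)^∣p∣
  sign : ∀ {d} → ℤ → ⟨ C d ⟩ → ⟨ C d ⟩
  sign p x = signℕ ∣ p ∣ x

record DGA {r ℓr} (R : CommutativeRing r ℓr) (m ℓm : Level)
       : Set (r ⊔ ℓr ⊔ lsuc (m ⊔ ℓm)) where
  open CommutativeRing R using () renaming (Carrier to K)
  field
    C   : ℤ → Module R m ℓm
    _·_ : ∀ {p q} → ⟨ C p ⟩ → ⟨ C q ⟩ → ⟨ C (p ⊕ q) ⟩
    ∂   : ∀ {p} → ⟨ C p ⟩ → ⟨ C (p ⊕ + 1) ⟩

  Eq : ∀ p → ⟨ C p ⟩ → ⟨ C p ⟩ → Set ℓm
  Eq p x y = Module._≈ᴹ_ (C p) x y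
  infix 4 Eq
  syntax Eq p x y = x ≈[ p ] y

  add : ∀ {p} → ⟨ C p ⟩ → ⟨ C p ⟩ → ⟨ C p ⟩
  add {p} = Module._+ᴹ_ (C p)

  neg : ∀ {p} → ⟨ C p ⟩ → ⟨ C p ⟩
  neg {p} = Module.-ᴹ_ (C p)

  zer : ∀ {p} → ⟨ C p ⟩
  zer {p} = Module.0ᴹ (C p)

  smul : ∀ {p} → K → ⟨ C p ⟩ → ⟨ C p ⟩
  smul {p} = Module._*ₗ_ (C p)

  field
    ∂-cong : ∀ {p} {x y : ⟨ C p ⟩} → x ≈[ p ] y → ∂ x ≈[ p ⊕ + 1 ] ∂ y
    ∂-+    : ∀ {p} (x y : ⟨ C p ⟩) → ∂ (add x y) ≈[ p ⊕ + 1 ] add (∂ x) (∂ y)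
    ∂-*ₗ   : ∀ {p} (λ' : K) (x : ⟨ C p ⟩) → ∂ (smul λ' x) ≈[ p ⊕ + 1 ] smul λ' (∂ x)
    ∂∂     : ∀ {p} (x : ⟨ C p ⟩) → ∂ (∂ x) ≈[ (p ⊕ + 1) ⊕ + 1 ] zer
    ·-cong : ∀ {p q} {x x' : ⟨ C p ⟩} {y y' : ⟨ C q ⟩} →
             x ≈[ p ] x' → y ≈[ q ] y' → (x · y) ≈[ p ⊕ q ] (x' · y')
    ·-distribʳ : ∀ {p q} (x x' : ⟨ C p ⟩) (y : ⟨ C q ⟩) →
                 (add x x' · y) ≈[ p ⊕ q ] add (x · y) (x' · y)
    ·-distribˡ : ∀ {p q} (x : ⟨ C p ⟩) (y y' : ⟨ C q ⟩) →
                 (x · add y y') ≈[ p ⊕ q ] add (x · y) (x · y')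
    ·-*ₗˡ : ∀ {p q} (λ' : K) (x : ⟨ C p ⟩) (y : ⟨ C q ⟩) →
            (smul λ' x · y) ≈[ p ⊕ q ] smul λ' (x · y)
    ·-*ₗʳ : ∀ {p q} (λ' : K) (x : ⟨ C p ⟩) (y : ⟨ C q ⟩) →
            (x · smul λ' y) ≈[ p ⊕ q ] smul λ' (x · y)
    ·-assoc : ∀ {p q s} (x : ⟨ C p ⟩) (y : ⟨ C q ⟩) (z : ⟨ C s ⟩) →
              cast C (deg-assoc p q s) ((x · y) · z) ≈[ p ⊕ (q ⊕ s) ] (x · (y · z))
    leibniz : ∀ {p q} (x : ⟨ C p ⟩) (y : ⟨ C q ⟩) →
              ∂ (x · y) ≈[ (p ⊕ q) ⊕ + 1 ]
                add (cast C (deg-left p q) (∂ x · y))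
                    (sign C p (cast C (deg-right p q) (x · ∂ y)))

module DGANotions {r ℓr m ℓm} {R : CommutativeRing r ℓr} (A : DGA R m ℓm) where
  open DGA A

  C¹ : Set m
  C¹ = ⟨ C (+ 1) ⟩

  C² : Set m
  C² = ⟨ C (+ 2) ⟩

  IsCocycle : ∀ p → ⟨ C p ⟩ → Set ℓm
  IsCocycle p x = ∂ x ≈[ p ⊕ + 1 ] zer

  SameClass : ∀ q → ⟨ C (q ⊕ + 1) ⟩ → ⟨ C (q ⊕ + 1) ⟩ → Set (m ⊔ ℓm)
  SameClass q x y = Σ ⟨ C q ⟩ λ b → ∂ b ≈[ q ⊕ + 1 ] add x (neg y)

  sumFrom : ∀ {p} → ℕ → ℕ → (ℕ → ⟨ C p ⟩) → ⟨ C p ⟩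
  sumFrom i zero    f = zer
  sumFrom i (suc k) f = add (f i) (sumFrom (suc i) k f)

  -- c̃_{ij} = - Σ_{t=i}^{j-1} c_{it} c_{t+1,j}   (indices 1-based; only
  -- the values c i j with 1 ≤ i ≤ j ≤ n are ever relevant)
  tilde : (ℕ → ℕ → C¹) → ℕ → ℕ → C²
  tilde c i j = neg (sumFrom i (j ∸ i) (λ t → c i t · c (suc t) j))

  IsDefiningSystem : ℕ → (ℕ → ℕ → C¹) → Set ℓm
  IsDefiningSystem n c = ∀ i j → 1 ≤ i → i ≤ j → j ≤ n → ¬ (i ≡ 1 × j ≡ n) →
                         tilde c i j ≈[ + 2 ] ∂ (c i j)

module Submission where

-- Let Unique k be the conclusion of the theorem for size k, and Solvable k say
-- that every k-tuple of 1-cocycles is the diagonal of a complete system (one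
-- satisfying the defining equation also at the corner (1, k)).  The hypothesis
-- for size n gives Solvable k for k < n, and Unique k follows for k ≤ n by
-- strong induction.  For defining systems d, d′ of size k:
--  * gauge transformations by 0-cochains make the diagonal of d′ equal to that
--    of d, changing c̃_{1k}(d′) by a coboundary;
--  * d′ is then moved, superdiagonal by superdiagonal, to agree with d: the
--    difference z at (i, i+ℓ) is a cocycle, completing a smaller system with z
--    on the cross of i gives a defining system f of size k - ℓ, and adding f to
--    a rectangle of d′ moves the entry and changes c̃_{1k} by ∂-exact c̃_{1,k-ℓ}(f);
--  * finally d and d′ agree at all entries entering c̃_{1k}.

open import Defs
open import Data.Nat using (ℕ; _≤_)
open import Data.Integer using (+_)
open import Data.Product using (Σ; _×_)
open import Algebra.Bundles using (CommutativeRing)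

open import Level using (_⊔_)
open import Data.Nat using (zero; suc; _<_; _∸_; z≤n; s≤s) renaming (_+_ to _+ℕ_)
open import Data.Nat.Properties
open import Data.Nat.Induction using (<-rec)
open import Algebra.Properties.CommutativeSemigroup +-commutativeSemigroup using (xy∙z≈xz∙y)
open import Data.Integer using (ℤ) renaming (_+_ to _+ℤ_)
open import Data.Product using (_,_; proj₁; proj₂)
open import Data.Sum using (_⊎_; inj₁; inj₂)
open import Data.Empty using (⊥-elim)
open import Function using (_∘_)
open import Relation.Nullary using (¬_; Dec; yes; no)
open import Relation.Nullary.Decidable using (_×-dec_)
open import Relation.Binary.PropositionalEquality as P using (_≡_; _≢_)
open import Algebra.Bundles using (AbelianGroup)
open import Algebra.Module.Bundles using (Module)
import Algebra.Properties.AbelianGroup as AbelianGroupProperties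
import Relation.Binary.Reasoning.Setoid as SetoidReasoning

-- Equality of indices as a plain case distinction.  Case splits on it do not
-- abstract the decisions  _≟_  made inside families defined by cases.
index-cases : (a b : ℕ) → (a ≡ b) ⊎ (a ≢ b)
index-cases a b with a ≟ b
... | yes a≡b = inj₁ a≡b
... | no  a≢b = inj₂ a≢b

module Massey {r ℓr m ℓm} {R : CommutativeRing r ℓr} (A : DGA R m ℓm) where
  open DGA A
  open DGANotions A

  module Deg (p : ℤ) where
    private
      G : AbelianGroup m ℓm
      G = Module.+ᴹ-abelianGroup (C p)
    open AbelianGroup G public using (setoid; refl; sym; trans; assoc; comm;
      identityˡ; identityʳ; inverseˡ; inverseʳ; ∙-cong; ∙-congˡ; ∙-congʳ; ⁻¹-cong)
    open AbelianGroupProperties G public using (ε⁻¹≈ε; ⁻¹-∙-comm; identityˡ-unique; inverseʳ-unique; xyx⁻¹≈y)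
    open SetoidReasoning setoid public

    X : Set m
    X = ⟨ C p ⟩

    _≈_ : X → X → Set ℓm
    _≈_ = Eq p
    _+_ : X → X → X
    _+_ = add {p}
    -_ : X → X
    -_ = neg {p}
    0# : X
    0# = zer {p}
    infix 4 _≈_
    infixl 6 _+_
    infix 8 -_

    ≡⇒≈ : ∀ {x y} → x ≡ y → x ≈ y
    ≡⇒≈ P.refl = refl

    interchange : ∀ a b c d → (a + b) + (c + d) ≈ (a + c) + (b + d)
    interchange a b c d = begin
      (a + b) + (c + d) ≈⟨ assoc a b (c + d) ⟩
      a + (b + (c + d)) ≈⟨ ∙-congˡ (sym (assoc b c d)) ⟩
      a + ((b + c) + d) ≈⟨ ∙-congˡ (∙-congʳ (comm b c)) ⟩
      a + ((c + b) + d) ≈⟨ ∙-congˡ (assoc c b d) ⟩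
      a + (c + (b + d)) ≈⟨ sym (assoc a c (b + d)) ⟩
      (a + c) + (b + d) ∎

    interchange₃ : ∀ a x b c y → (a + x) + (b + (c + y)) ≈ (a + (b + c)) + (x + y)
    interchange₃ a x b c y = trans (∙-congˡ (sym (assoc b c y))) (interchange a x (b + c) y)

    sub-add : ∀ x y → (x + - y) + y ≈ x
    sub-add x y = trans (assoc x (- y) y) (trans (∙-congˡ (inverseˡ y)) (identityʳ x))

    add-sub : ∀ x y → x + (y + - x) ≈ y
    add-sub x y = trans (comm x (y + - x)) (sub-add y x)

    neg-+ : ∀ x y → - (x + y) ≈ - x + - y
    neg-+ x y = sym (⁻¹-∙-comm x y)

    cancel-middle : ∀ a b c d → d ≈ b → (a + - b) + (c + d) ≈ a + c
    cancel-middle a b c d d≈b = begin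
      (a + - b) + (c + d) ≈⟨ interchange a (- b) c d ⟩
      (a + c) + (- b + d) ≈⟨ ∙-congˡ (trans (∙-congˡ d≈b) (inverseˡ b)) ⟩
      (a + c) + 0#        ≈⟨ identityʳ _ ⟩
      a + c               ∎

    S : ℕ → ℕ → (ℕ → X) → X
    S = sumFrom {p}

    S-cong : ∀ i k {f g : ℕ → X} → (∀ t → i ≤ t → t < i +ℕ k → f t ≈ g t) → S i k f ≈ S i k g
    S-cong i zero    f≈g = refl
    S-cong i (suc k) f≈g = ∙-cong (f≈g i ≤-refl (m<m+n i (s≤s z≤n)))
      (S-cong (suc i) k (λ t i<t t< → f≈g t (<⇒≤ i<t) (P.subst (t <_) (P.sym (+-suc i k)) t<)))

    S-++ : ∀ i a b (f : ℕ → X) → S i (a +ℕ b) f ≈ S i a f + S (i +ℕ a) b f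
    S-++ i zero b f = P.subst (λ i' → S i b f ≈ 0# + S i' b f) (P.sym (+-identityʳ i)) (sym (identityˡ _))
    S-++ i (suc a) b f = begin
      f i + S (suc i) (a +ℕ b) f                 ≈⟨ ∙-congˡ (S-++ (suc i) a b f) ⟩
      f i + (S (suc i) a f + S (suc i +ℕ a) b f) ≈⟨ sym (assoc _ _ _) ⟩
      (f i + S (suc i) a f) + S (suc i +ℕ a) b f ≡⟨ P.cong (λ i' → (f i + S (suc i) a f) + S i' b f) (P.sym (+-suc i a)) ⟩
      (f i + S (suc i) a f) + S (i +ℕ suc a) b f ∎

    S-+ : ∀ i k (f g : ℕ → X) → S i k (λ t → f t + g t) ≈ S i k f + S i k g
    S-+ i zero    f g = sym (identityˡ 0#)
    S-+ i (suc k) f g = trans (∙-congˡ (S-+ (suc i) k f g)) (interchange _ _ _ _)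

    S-shift : ∀ i k s (f : ℕ → X) → S i k (λ t → f (t +ℕ s)) ≡ S (i +ℕ s) k f
    S-shift i zero    s f = P.refl
    S-shift i (suc k) s f = P.cong (λ z → f (i +ℕ s) + z) (S-shift (suc i) k s f)

    ∑ : ℕ → ℕ → (ℕ → X) → X
    ∑ i j f = S i (j ∸ i) f

    ∑-cong : ∀ i j {f g : ℕ → X} → (∀ t → i ≤ t → t < j → f t ≈ g t) → ∑ i j f ≈ ∑ i j g
    ∑-cong i j f≈g with i ≤? j
    ... | yes i≤j = S-cong i (j ∸ i) (λ t i≤t t< → f≈g t i≤t (P.subst (t <_) (m+[n∸m]≡n i≤j) t<))
    ... | no  i≰j rewrite m≤n⇒m∸n≡0 (<⇒≤ (≰⇒> i≰j)) = refl

    ∑-split : ∀ i k j (f : ℕ → X) → i ≤ k → k ≤ j → ∑ i j f ≈ ∑ i k f + ∑ k j f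
    ∑-split i k j f i≤k k≤j = begin
      S i (j ∸ i) f                               ≡⟨ P.cong (λ l → S i l f) lengths ⟩
      S i ((k ∸ i) +ℕ (j ∸ k)) f                  ≈⟨ S-++ i (k ∸ i) (j ∸ k) f ⟩
      S i (k ∸ i) f + S (i +ℕ (k ∸ i)) (j ∸ k) f  ≡⟨ P.cong (λ i' → S i (k ∸ i) f + S i' (j ∸ k) f) (m+[n∸m]≡n i≤k) ⟩
      S i (k ∸ i) f + S k (j ∸ k) f               ∎
      where
      lengths : j ∸ i ≡ (k ∸ i) +ℕ (j ∸ k)
      lengths = P.trans (P.cong (_∸ i) (P.sym (m∸n+n≡m k≤j)))
                  (P.trans (+-∸-assoc (j ∸ k) i≤k) (+-comm (j ∸ k) (k ∸ i)))

    ∑-split₃ : ∀ a i j b (h : ℕ → X) → a ≤ i → i ≤ j → j ≤ b → ∑ a b h ≈ ∑ a i h + (∑ i j h + ∑ j b h)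
    ∑-split₃ a i j b h a≤i i≤j j≤b = trans (∑-split a i b h a≤i (≤-trans i≤j j≤b)) (∙-congˡ (∑-split i j b h i≤j j≤b))

    ∑-empty : ∀ i (f : ℕ → X) → ∑ i i f ≈ 0#
    ∑-empty i f = ≡⇒≈ (P.cong (λ l → S i l f) (n∸n≡0 i))

    ∑-single : ∀ i (f : ℕ → X) → ∑ i (suc i) f ≈ f i
    ∑-single i f = trans (≡⇒≈ (P.cong (λ l → S i l f) one)) (identityʳ (f i))
      where
      one : suc i ∸ i ≡ 1
      one = P.trans (+-∸-assoc 1 (≤-refl {i})) (P.cong suc (n∸n≡0 i))

    ∑-first : ∀ i j (f : ℕ → X) → i < j → ∑ i j f ≈ f i + ∑ (suc i) j f
    ∑-first i j f i<j = trans (∑-split i (suc i) j f (n≤1+n i) i<j) (∙-congʳ (∑-single i f))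

    ∑-last : ∀ i j (f : ℕ → X) → i ≤ j → ∑ i (suc j) f ≈ ∑ i j f + f j
    ∑-last i j f i≤j = trans (∑-split i j (suc j) f i≤j (n≤1+n j)) (∙-congˡ (∑-single j f))

    ∑-+ : ∀ i j (f g : ℕ → X) → ∑ i j (λ t → f t + g t) ≈ ∑ i j f + ∑ i j g
    ∑-+ i j = S-+ i (j ∸ i)

    ∑-shift : ∀ i j s (f : ℕ → X) → ∑ i j (λ t → f (t +ℕ s)) ≡ ∑ (i +ℕ s) (j +ℕ s) f
    ∑-shift i j s f = P.trans (S-shift i (j ∸ i) s f) (P.cong (λ l → S (i +ℕ s) l f) (P.sym shifted))
      where
      shifted : (j +ℕ s) ∸ (i +ℕ s) ≡ j ∸ i
      shifted = P.trans (P.cong₂ _∸_ (+-comm j s) (+-comm i s)) ([m+n]∸[m+o]≡n∸o s j i)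

    ∑-pair : ∀ a t b {f g : ℕ → X} → a ≤ t → suc t < b →
             (∀ u → a ≤ u → u < b → u ≢ t → u ≢ suc t → f u ≈ g u) →
             f t + f (suc t) ≈ g t + g (suc t) → ∑ a b f ≈ ∑ a b g
    ∑-pair a t b {f} {g} a≤t t+1<b f≈g pair = begin
      ∑ a b f                                      ≈⟨ around f ⟩
      ∑ a t f + ((f t + f (suc t)) + ∑ t+2 b f)    ≈⟨ ∙-cong before (∙-cong pair after) ⟩
      ∑ a t g + ((g t + g (suc t)) + ∑ t+2 b g)    ≈⟨ sym (around g) ⟩
      ∑ a b g                                      ∎
      where
      t+2 = suc (suc t)
      t<b = <-trans (n<1+n t) t+1<b
      around : ∀ h → ∑ a b h ≈ ∑ a t h + ((h t + h (suc t)) + ∑ t+2 b h)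
      around h = begin
        ∑ a b h                                   ≈⟨ ∑-split a t b h a≤t (<⇒≤ t<b) ⟩
        ∑ a t h + ∑ t b h                         ≈⟨ ∙-congˡ (∑-first t b h t<b) ⟩
        ∑ a t h + (h t + ∑ (suc t) b h)           ≈⟨ ∙-congˡ (∙-congˡ (∑-first (suc t) b h t+1<b)) ⟩
        ∑ a t h + (h t + (h (suc t) + ∑ t+2 b h)) ≈⟨ ∙-congˡ (sym (assoc _ _ _)) ⟩
        ∑ a t h + ((h t + h (suc t)) + ∑ t+2 b h) ∎
      before : ∑ a t f ≈ ∑ a t g
      before = ∑-cong a t (λ u a≤u u<t → f≈g u a≤u (<-trans u<t t<b) (<⇒≢ u<t) (<⇒≢ (<-trans u<t (n<1+n t))))
      after : ∑ t+2 b f ≈ ∑ t+2 b g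
      after = ∑-cong t+2 b (λ u t+2≤u u<b → f≈g u (≤-trans a≤t (≤-trans (n≤1+n t) (≤-trans (n≤1+n (suc t)) t+2≤u))) u<b
        (λ u≡t → <-irrefl (P.sym u≡t) (≤-trans (n≤1+n (suc t)) t+2≤u)) (λ u≡t+1 → <-irrefl (P.sym u≡t+1) t+2≤u))

  module C0 = Deg (+ 0)
  module C1 = Deg (+ 1)
  module C2 = Deg (+ 2)

  module Additive {p q : ℤ} (f : ⟨ C p ⟩ → ⟨ C q ⟩)
      (f-cong : ∀ {x y} → x ≈[ p ] y → f x ≈[ q ] f y)
      (f-+ : ∀ x y → f (add x y) ≈[ q ] add (f x) (f y)) where
    private
      module Cp = Deg p
      module Cq = Deg q

    f-0 : f Cp.0# Cq.≈ Cq.0#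
    f-0 = Cq.identityˡ-unique (f Cp.0#) (f Cp.0#)
            (Cq.trans (Cq.sym (f-+ Cp.0# Cp.0#)) (f-cong (Cp.identityˡ Cp.0#)))

    f-neg : ∀ x → f (Cp.- x) Cq.≈ Cq.- f x
    f-neg x = Cq.inverseʳ-unique (f x) (f (Cp.- x))
                (Cq.trans (Cq.sym (f-+ x (Cp.- x))) (Cq.trans (f-cong (Cp.inverseʳ x)) f-0))

    f-S : ∀ i k (g : ℕ → Cp.X) → f (Cp.S i k g) Cq.≈ Cq.S i k (f ∘ g)
    f-S i zero    g = f-0
    f-S i (suc k) g = Cq.trans (f-+ _ _) (Cq.∙-congˡ (f-S (suc i) k g))

    f-∑ : ∀ i j (g : ℕ → Cp.X) → f (Cp.∑ i j g) Cq.≈ Cq.∑ i j (f ∘ g)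
    f-∑ i j = f-S i (j ∸ i)

  module ∂-additive {p : ℤ} = Additive {p} ∂ ∂-cong ∂-+
  module ·-additiveʳ {p q : ℤ} (x : ⟨ C p ⟩) = Additive {q} (x ·_) (·-cong (Deg.refl p)) (·-distribˡ x)
  module ·-additiveˡ {p q : ℤ} (y : ⟨ C q ⟩) = Additive {p} (_· y) (λ e → ·-cong e (Deg.refl q)) (λ x x' → ·-distribʳ x x' y)
  module neg-additive {p : ℤ} = Additive {p} neg (Deg.⁻¹-cong p) (Deg.neg-+ p)

  module Classes (q : ℤ) where
    private
      module Cq = Deg q
      module Cq+1 = Deg (q +ℤ + 1)
      open ∂-additive {q}

    same-≈ : ∀ {x y} → x Cq+1.≈ y → SameClass q x y
    same-≈ {x} {y} x≈y = Cq.0# , Cq+1.trans f-0 (Cq+1.sym (Cq+1.trans (Cq+1.∙-congʳ x≈y) (Cq+1.inverseʳ y)))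

    same-refl : ∀ {x} → SameClass q x x
    same-refl = same-≈ Cq+1.refl

    same-trans : ∀ {x y z} → SameClass q x y → SameClass q y z → SameClass q x z
    same-trans {x} {y} {z} (b , ∂b≈x-y) (b' , ∂b'≈y-z) = b Cq.+ b' , (begin
      ∂ (b Cq.+ b')           ≈⟨ ∂-+ b b' ⟩
      ∂ b + ∂ b'              ≈⟨ ∙-cong ∂b≈x-y ∂b'≈y-z ⟩
      (x + - y) + (y + - z)   ≈⟨ interchange x (- y) y (- z) ⟩
      (x + y) + (- y + - z)   ≈⟨ ∙-congʳ (comm x y) ⟩
      (y + x) + (- y + - z)   ≈⟨ interchange y x (- y) (- z) ⟩
      (y + - y) + (x + - z)   ≈⟨ ∙-congʳ (inverseʳ y) ⟩
      0# + (x + - z)          ≈⟨ identityˡ _ ⟩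
      x + - z                 ∎)
      where open Cq+1

    same-+∂ : ∀ x (b : Cq.X) → SameClass q (x Cq+1.+ ∂ b) x
    same-+∂ x b = b , Cq+1.sym (Cq+1.xyx⁻¹≈y x (∂ b))

  module Cl0 = Classes (+ 0)
  module Cl1 = Classes (+ 1)

  C⁰ : Set m
  C⁰ = ⟨ C (+ 0) ⟩

  Family : Set m
  Family = ℕ → ℕ → C¹

  Eqn : Family → ℕ → ℕ → Set ℓm
  Eqn c i j = tilde c i j C2.≈ ∂ (c i j)

  -- A complete system of size k: the defining equation holds also at the
  -- corner (1, k), i.e. the Massey product of the diagonal contains 0.
  Complete : ℕ → Family → Set ℓm
  Complete k c = ∀ i j → 1 ≤ i → i ≤ j → j ≤ k → Eqn c i j

  tilde-cong : ∀ (c c' : Family) i j →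
               (∀ t → i ≤ t → t < j → (c i t C1.≈ c' i t) × (c (suc t) j C1.≈ c' (suc t) j)) →
               tilde c i j C2.≈ tilde c' i j
  tilde-cong c c' i j c≈c' = C2.⁻¹-cong (C2.∑-cong i j (λ t i≤t t<j →
    ·-cong (proj₁ (c≈c' t i≤t t<j)) (proj₂ (c≈c' t i≤t t<j))))

  tilde-diag : ∀ (c : Family) i → tilde c i i C2.≈ C2.0#
  tilde-diag c i = C2.trans (C2.⁻¹-cong (C2.∑-empty i _)) C2.ε⁻¹≈ε

  tilde-shift : ∀ (c : Family) s i j → tilde (λ a b → c (a +ℕ s) (b +ℕ s)) i j ≡ tilde c (i +ℕ s) (j +ℕ s)
  tilde-shift c s i j = P.cong C2.-_ (C2.∑-shift i j s (λ u → c (i +ℕ s) u · c (suc u) (j +ℕ s)))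

  diag-cocycle : ∀ (c : Family) i → Eqn c i i → IsCocycle (+ 1) (c i i)
  diag-cocycle c i eqn = C2.trans (C2.sym eqn) (tilde-diag c i)

  eqn-transfer : ∀ (e g : Family) p q (δ : C¹) → g p q C1.≈ e p q C1.+ δ →
                 tilde g p q C2.≈ tilde e p q C2.+ ∂ δ → Eqn e p q → Eqn g p q
  eqn-transfer e g p q δ g≈e+δ tg≈te+∂δ eqn = C2.trans tg≈te+∂δ (C2.trans (C2.∙-congʳ eqn)
    (C2.trans (C2.sym (∂-+ (e p q) δ)) (∂-cong (C1.sym g≈e+δ))))

  eqn-same : ∀ (e g : Family) p q → g p q C1.≈ e p q → tilde g p q C2.≈ tilde e p q → Eqn e p q → Eqn g p q
  eqn-same e g p q g≈e tg≈te eqn = C2.trans tg≈te (C2.trans eqn (∂-cong (C1.sym g≈e)))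

  DefiningSystemsExist : ℕ → Set (m ⊔ ℓm)
  DefiningSystemsExist n = ∀ (c : ℕ → C¹) → (∀ i → 1 ≤ i → i ≤ n → IsCocycle (+ 1) (c i)) →
    Σ (ℕ → ℕ → C¹) (λ d → IsDefiningSystem n d × (∀ i → 1 ≤ i → i ≤ n → d i i C1.≈ c i))

  Solvable : ℕ → Set (m ⊔ ℓm)
  Solvable k = ∀ (c : ℕ → C¹) → (∀ i → 1 ≤ i → i ≤ k → IsCocycle (+ 1) (c i)) →
    Σ Family (λ D → Complete k D × (∀ i → 1 ≤ i → i ≤ k → D i i C1.≈ c i))

  SameDiagonal : ℕ → Family → Family → Set (m ⊔ ℓm)
  SameDiagonal k d e = ∀ p → 1 ≤ p → p ≤ k → SameClass (+ 0) (d p p) (e p p)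

  Unique : ℕ → Set (m ⊔ ℓm)
  Unique k = ∀ (d e : Family) → IsDefiningSystem k d → IsDefiningSystem k e →
             SameDiagonal k d e → SameClass (+ 1) (tilde d 1 k) (tilde e 1 k)

  -- If defining systems of size n always exist, then every smaller system
  -- is complete: restrict a defining system whose diagonal is padded by 0.
  solvable-below : ∀ n → DefiningSystemsExist n → ∀ k → k < n → Solvable k
  solvable-below n exist k k<n c cocycle = D , complete , diagonal
    where
    pad : ℕ → C¹
    pad i with i ≤? k
    ... | yes _ = c i
    ... | no  _ = C1.0#
    pad-cocycle : ∀ i → 1 ≤ i → i ≤ n → IsCocycle (+ 1) (pad i)
    pad-cocycle i 1≤i _ with i ≤? k
    ... | yes i≤k = cocycle i 1≤i i≤k
    ... | no  _   = ∂-additive.f-0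
    system = exist pad pad-cocycle
    D = proj₁ system
    complete : Complete k D
    complete i j 1≤i i≤j j≤k = proj₁ (proj₂ system) i j 1≤i i≤j (≤-trans j≤k (<⇒≤ k<n))
      (λ { (_ , j≡n) → <-irrefl j≡n (≤-<-trans j≤k k<n) })
    diagonal : ∀ i → 1 ≤ i → i ≤ k → D i i C1.≈ c i
    diagonal i 1≤i i≤k with proj₂ (proj₂ system) i 1≤i (≤-trans i≤k (<⇒≤ k<n))
    ... | D≈pad with i ≤? k
    ...   | yes _   = D≈pad
    ...   | no  i≰k = ⊥-elim (i≰k i≤k)

  -- If the Massey product of size k is well defined and always contains 0,
  -- then c̃_{1k} is a coboundary for every defining system h of size k:
  -- it is cohomologous to c̃_{1k} = ∂ D_{1k} of a complete system D.
  corner-exact : ∀ k → 2 ≤ k → Unique k → Solvable k → ∀ h → IsDefiningSystem k h →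
                 Σ C¹ (λ x → ∂ x C2.≈ tilde h 1 k)
  corner-exact k 2≤k unique solvable h system = b C1.+ D 1 k , (begin
      ∂ (b C1.+ D 1 k)                ≈⟨ ∂-+ b (D 1 k) ⟩
      ∂ b + ∂ (D 1 k)                 ≈⟨ ∙-cong ∂b≈ (sym (complete 1 k ≤-refl (≤-trans (n≤1+n 1) 2≤k) ≤-refl)) ⟩
      (tilde h 1 k + - tilde D 1 k) + tilde D 1 k ≈⟨ sub-add _ _ ⟩
      tilde h 1 k                     ∎)
    where
    open C2
    non-corner : ∀ u → ¬ (u ≡ 1 × u ≡ k)
    non-corner u (u≡1 , u≡k) = <-irrefl (P.trans (P.sym u≡1) u≡k) 2≤k
    cocycle : ∀ u → 1 ≤ u → u ≤ k → IsCocycle (+ 1) (h u u)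
    cocycle u 1≤u u≤k = diag-cocycle h u (system u u 1≤u ≤-refl u≤k (non-corner u))
    solution = solvable (λ u → h u u) cocycle
    D = proj₁ solution
    complete = proj₁ (proj₂ solution)
    classes = unique h D system (λ i j 1≤i i≤j j≤k _ → complete i j 1≤i i≤j j≤k)
                (λ u 1≤u u≤k → Cl0.same-≈ (C1.sym (proj₂ (proj₂ solution) u 1≤u u≤k)))
    b = proj₁ classes
    ∂b≈ = proj₂ classes

  Closed : (ℕ → ℕ → Set) → Set
  Closed P = ∀ {a b t} → P a b → a ≤ t → t < b → P a t × P (suc t) b

  tilde-closed : ∀ (P : ℕ → ℕ → Set) → Closed P → ∀ (g e : Family) →
                 (∀ a b → a ≤ b → P a b → g a b C1.≈ e a b) → ∀ p q → P p q → tilde g p q C2.≈ tilde e p q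
  tilde-closed P closed g e g≈e p q pq = tilde-cong g e p q (λ t p≤t t<q →
    g≈e p t p≤t (proj₁ (closed pq p≤t t<q)) , g≈e (suc t) q t<q (proj₂ (closed pq p≤t t<q)))

  eqn-closed : ∀ (P : ℕ → ℕ → Set) → Closed P → ∀ (e g : Family) →
               (∀ a b → a ≤ b → P a b → g a b C1.≈ e a b) → ∀ p q → p ≤ q → P p q → Eqn e p q → Eqn g p q
  eqn-closed P closed e g g≈e p q p≤q pq = eqn-same e g p q (g≈e p q p≤q pq) (tilde-closed P closed g e g≈e p q pq)

  Avoids : ℕ → ℕ → ℕ → Set
  Avoids i a b = b < i ⊎ i < a

  avoids-closed : ∀ i → Closed (Avoids i)
  avoids-closed i (inj₁ b<i) a≤t t<b = inj₁ (<-trans t<b b<i) , inj₁ b<i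
  avoids-closed i (inj₂ i<a) a≤t t<b = inj₂ i<a , inj₂ (<-≤-trans i<a (≤-trans a≤t (n≤1+n _)))

  avoids-≢ : ∀ {i a b} → a ≤ b → Avoids i a b → (a ≢ i) × (b ≢ i)
  avoids-≢ a≤b (inj₁ b<i) = (λ a≡i → <-irrefl a≡i (≤-<-trans a≤b b<i)) , (λ b≡i → <-irrefl b≡i b<i)
  avoids-≢ a≤b (inj₂ i<a) = (λ a≡i → <-irrefl (P.sym a≡i) i<a) , (λ b≡i → <-irrefl (P.sym b≡i) (<-≤-trans i<a a≤b))

  avoids? : ∀ i a b → (a ≤ i × i ≤ b) ⊎ Avoids i a b
  avoids? i a b with b <? i | i <? a
  ... | yes b<i | _       = inj₂ (inj₁ b<i)
  ... | no  _   | yes i<a = inj₂ (inj₂ i<a)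
  ... | no  b≮i | no  i≮a = inj₁ (≮⇒≥ i≮a , ≮⇒≥ b≮i)

  -- Gauge transformation by a 0-cochain β at the index i = i'+1.  Only row i
  -- and column i change:
  --   g_ii = e_ii + ∂β,   g_iq = e_iq - β e_{i+1,q},   g_pi = e_pi + e_{p,i-1} β.
  module Gauge (e : Family) (i' : ℕ) (β : C⁰) where
    i : ℕ
    i = suc i'

    g : Family
    g p q with p ≟ i | q ≟ i
    ... | yes _ | yes _ = e p q C1.+ ∂ β
    ... | yes _ | no  _ = e p q C1.+ C1.- (β · e (suc i) q)
    ... | no  _ | yes _ = e p q C1.+ (e p i' · β)
    ... | no  _ | no  _ = e p q

    g-ii : g i i ≡ e i i C1.+ ∂ β
    g-ii with i ≟ i
    ... | yes _  = P.refl
    ... | no i≢i = ⊥-elim (i≢i P.refl)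

    g-iq : ∀ q → q ≢ i → g i q ≡ e i q C1.+ C1.- (β · e (suc i) q)
    g-iq q q≢i with i ≟ i | q ≟ i
    ... | yes _  | no  _   = P.refl
    ... | yes _  | yes q≡i = ⊥-elim (q≢i q≡i)
    ... | no i≢i | _       = ⊥-elim (i≢i P.refl)

    g-pi : ∀ p → p ≢ i → g p i ≡ e p i C1.+ (e p i' · β)
    g-pi p p≢i with p ≟ i | i ≟ i
    ... | no  _   | yes _  = P.refl
    ... | yes p≡i | _      = ⊥-elim (p≢i p≡i)
    ... | no  _   | no i≢i = ⊥-elim (i≢i P.refl)

    g-pq : ∀ p q → p ≢ i → q ≢ i → g p q ≡ e p q
    g-pq p q p≢i q≢i with p ≟ i | q ≟ i
    ... | no  _   | no  _   = P.refl
    ... | yes p≡i | _       = ⊥-elim (p≢i p≡i)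
    ... | no  _   | yes q≡i = ⊥-elim (q≢i q≡i)

    term-g term-e : ℕ → ℕ → ℕ → C²
    term-g p q t = g p t · g (suc t) q
    term-e p q t = e p t · e (suc t) q

    -- Across the index i (p < i < q) only the summands t = i-1, i change,
    -- and their changes  -e_{p,i-1} β e_{i+1,q}  and  e_{p,i-1} β e_{i+1,q}  cancel.
    tilde-across : ∀ p q → p < i → i < q → tilde g p q C2.≈ tilde e p q
    tilde-across p q p<i i<q = C2.⁻¹-cong (C2.∑-pair p i' q (≤-pred p<i) i<q unchanged pair)
      where
      p≢i : p ≢ i
      p≢i = <⇒≢ p<i
      q≢i : q ≢ i
      q≢i q≡i = <-irrefl (P.sym q≡i) i<q
      unchanged : ∀ t → p ≤ t → t < q → t ≢ i' → t ≢ i → term-g p q t C2.≈ term-e p q t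
      unchanged t _ _ t≢i' t≢i =
        C2.≡⇒≈ (P.cong₂ _·_ (g-pq p t p≢i t≢i) (g-pq (suc t) q (t≢i' ∘ suc-injective) q≢i))
      x = e p i' ; w = e i q ; u = e p i ; y = e (suc i) q
      pair : term-g p q i' C2.+ term-g p q i C2.≈ term-e p q i' C2.+ term-e p q i
      pair = begin
        term-g p q i' + term-g p q i
          ≡⟨ P.cong₂ _+_ (P.cong₂ _·_ (g-pq p i' p≢i (<⇒≢ (n<1+n i'))) (g-iq q q≢i))
                         (P.cong₂ _·_ (g-pi p p≢i) (g-pq (suc i) q (<⇒≢ (n<1+n i) ∘ P.sym) q≢i)) ⟩
        (x · (w C1.+ C1.- (β · y))) + ((u C1.+ (x · β)) · y)
          ≈⟨ ∙-cong (trans (·-distribˡ x w _) (∙-congˡ (·-additiveʳ.f-neg x (β · y)))) (·-distribʳ u (x · β) y) ⟩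
        ((x · w) + - (x · (β · y))) + ((u · y) + ((x · β) · y))
          ≈⟨ cancel-middle _ _ _ _ (·-assoc x β y) ⟩
        (x · w) + (u · y) ∎
        where open C2

    -- In row i the change of c̃_{iq} is ∂ of the change -β e_{i+1,q} of
    -- the entry: by the Leibniz rule and the defining equation at (i+1, q).
    tilde-row : ∀ q → i < q → Eqn e (suc i) q → tilde g i q C2.≈ tilde e i q C2.+ ∂ (C1.- (β · e (suc i) q))
    tilde-row q i<q eqn = begin
      - ∑ i q (term-g i q)                      ≈⟨ ⁻¹-cong sum ⟩
      - (∑ i q (term-e i q) + ∂β·y+β·∂y)        ≈⟨ neg-+ _ _ ⟩
      tilde e i q + - ∂β·y+β·∂y                 ≈⟨ ∙-congˡ (sym ∂[-βy]) ⟩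
      tilde e i q + ∂ (C1.- (β · y))            ∎
      where
      open C2
      y = e (suc i) q
      h : ℕ → C²
      h t = e (suc i) t · e (suc t) q
      ∂[-βy] : ∂ (C1.- (β · y)) ≈ - ((∂ β · y) + (β · ∂ y))
      ∂[-βy] = trans (∂-additive.f-neg (β · y)) (⁻¹-cong (leibniz β y))
      ∂β·y+β·∂y = (∂ β · y) + (β · ∂ y)
      q≢i : q ≢ i
      q≢i q≡i = <-irrefl (P.sym q≡i) i<q
      first : term-g i q i ≈ term-e i q i + (∂ β · y)
      first = trans (≡⇒≈ (P.cong₂ _·_ g-ii (g-pq (suc i) q (<⇒≢ (n<1+n i) ∘ P.sym) q≢i))) (·-distribʳ _ _ _)
      later : ∀ t → suc i ≤ t → t < q → term-g i q t ≈ term-e i q t + - (β · h t)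
      later t i<t t<q = begin
        term-g i q t                                      ≡⟨ P.cong₂ _·_ (g-iq t (<⇒≢ i<t ∘ P.sym))
                                                               (g-pq (suc t) q (<⇒≢ (≤-trans i<t (n≤1+n t)) ∘ P.sym) q≢i) ⟩
        (e i t C1.+ C1.- (β · e (suc i) t)) · e (suc t) q  ≈⟨ ·-distribʳ _ _ _ ⟩
        term-e i q t + ((C1.- (β · e (suc i) t)) · e (suc t) q)
                                                          ≈⟨ ∙-congˡ (·-additiveˡ.f-neg (e (suc t) q) (β · e (suc i) t)) ⟩
        term-e i q t + - ((β · e (suc i) t) · e (suc t) q) ≈⟨ ∙-congˡ (⁻¹-cong (·-assoc β (e (suc i) t) (e (suc t) q))) ⟩
        term-e i q t + - (β · h t)                        ∎
      -- β · ∑ h = β · (- c̃_{i+1,q}) = - β · ∂ y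
      rest : ∑ (suc i) q (λ t → - (β · h t)) ≈ β · ∂ y
      rest = begin
        ∑ (suc i) q (λ t → - (β · h t)) ≈⟨ sym (neg-additive.f-∑ (suc i) q (λ t → β · h t)) ⟩
        - ∑ (suc i) q (λ t → β · h t)   ≈⟨ ⁻¹-cong (sym (·-additiveʳ.f-∑ β (suc i) q h)) ⟩
        - (β · ∑ (suc i) q h)           ≈⟨ sym (·-additiveʳ.f-neg β (∑ (suc i) q h)) ⟩
        β · tilde e (suc i) q           ≈⟨ ·-cong C0.refl eqn ⟩
        β · ∂ y                         ∎
      sum : ∑ i q (term-g i q) ≈ ∑ i q (term-e i q) + ∂β·y+β·∂y
      sum = begin
        ∑ i q (term-g i q)                                     ≈⟨ ∑-first i q _ i<q ⟩
        term-g i q i + ∑ (suc i) q (term-g i q)                ≈⟨ ∙-cong first (∑-cong (suc i) q later) ⟩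
        (term-e i q i + (∂ β · y)) + ∑ (suc i) q (λ t → term-e i q t + - (β · h t))
                                                               ≈⟨ ∙-congˡ (trans (∑-+ (suc i) q _ _) (∙-congˡ rest)) ⟩
        (term-e i q i + (∂ β · y)) + (∑ (suc i) q (term-e i q) + (β · ∂ y))
                                                               ≈⟨ interchange _ _ _ _ ⟩
        (term-e i q i + ∑ (suc i) q (term-e i q)) + ∂β·y+β·∂y  ≈⟨ ∙-congʳ (sym (∑-first i q _ i<q)) ⟩
        ∑ i q (term-e i q) + ∂β·y+β·∂y                         ∎

    -- In column i the change of c̃_{pi} is ∂ of the change e_{p,i-1} β of
    -- the entry: by the Leibniz rule and the defining equation at (p, i-1).
    tilde-col : ∀ p → p < i → Eqn e p i' → tilde g p i C2.≈ tilde e p i C2.+ ∂ (e p i' · β)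
    tilde-col p p<i eqn = begin
      - ∑ p i (term-g p i)                      ≈⟨ ⁻¹-cong sum ⟩
      - (∑ p i (term-e p i) + Σh·β+x·∂β)        ≈⟨ neg-+ _ _ ⟩
      tilde e p i + - Σh·β+x·∂β                 ≈⟨ ∙-congˡ (sym ∂xβ) ⟩
      tilde e p i + ∂ (x · β)                   ∎
      where
      open C2
      x = e p i'
      h : ℕ → C²
      h t = e p t · e (suc t) i'
      Σh·β+x·∂β = (∑ p i' h · β) + (x · ∂ β)
      open ·-additiveˡ β using () renaming (f-∑ to Σh·β)
      p≤i' = ≤-pred p<i
      p≢i : p ≢ i
      p≢i = <⇒≢ p<i
      last : term-g p i i' ≈ term-e p i i' + (x · ∂ β)
      last = trans (≡⇒≈ (P.cong₂ _·_ (g-pq p i' p≢i (<⇒≢ (n<1+n i'))) g-ii)) (·-distribˡ _ _ _)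
      earlier : ∀ t → p ≤ t → t < i' → term-g p i t ≈ term-e p i t + (h t · β)
      earlier t _ t<i' = trans (≡⇒≈ (P.cong₂ _·_ (g-pq p t p≢i (<⇒≢ (<-trans t<i' (n<1+n i'))))
                                                   (g-pi (suc t) (<⇒≢ (s≤s t<i')))))
        (trans (·-distribˡ _ _ _) (∙-congˡ (sym (·-assoc (e p t) (e (suc t) i') β))))
      sum : ∑ p i (term-g p i) ≈ ∑ p i (term-e p i) + Σh·β+x·∂β
      sum = begin
        ∑ p i (term-g p i)                                    ≈⟨ ∑-last p i' _ p≤i' ⟩
        ∑ p i' (term-g p i) + term-g p i i'                   ≈⟨ ∙-cong (∑-cong p i' earlier) last ⟩
        ∑ p i' (λ t → term-e p i t + (h t · β)) + (term-e p i i' + (x · ∂ β))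
                                                              ≈⟨ ∙-congʳ (trans (∑-+ p i' _ _) (∙-congˡ (sym (Σh·β p i' h)))) ⟩
        (∑ p i' (term-e p i) + (∑ p i' h · β)) + (term-e p i i' + (x · ∂ β))
                                                              ≈⟨ interchange _ _ _ _ ⟩
        (∑ p i' (term-e p i) + term-e p i i') + Σh·β+x·∂β     ≈⟨ ∙-congʳ (sym (∑-last p i' _ p≤i')) ⟩
        ∑ p i (term-e p i) + Σh·β+x·∂β                        ∎
      -- ∂(x β) = ∂x β - x ∂β = (- ∑ h) β - x ∂β
      ∂xβ : ∂ (x · β) ≈ - Σh·β+x·∂β
      ∂xβ = begin
        ∂ (x · β)                       ≈⟨ leibniz x β ⟩
        (∂ x · β) + - (x · ∂ β)         ≈⟨ ∙-congʳ (·-cong (C2.sym eqn) C0.refl) ⟩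
        ((- ∑ p i' h) · β) + - (x · ∂ β) ≈⟨ ∙-congʳ (·-additiveˡ.f-neg β (∑ p i' h)) ⟩
        - (∑ p i' h · β) + - (x · ∂ β)  ≈⟨ sym (neg-+ _ _) ⟩
        - Σh·β+x·∂β                     ∎

    -- at (i, i) both sides vanish, as ∂∂β = 0
    tilde-ii : tilde g i i C2.≈ tilde e i i C2.+ ∂ (∂ β)
    tilde-ii = C2.trans (tilde-diag g i) (C2.sym (C2.trans (C2.∙-cong (tilde-diag e i) (∂∂ β)) (C2.identityˡ _)))

    unchanged : ∀ a b → a ≤ b → Avoids i a b → g a b C1.≈ e a b
    unchanged a b a≤b avoids = C1.≡⇒≈ (g-pq a b (proj₁ (avoids-≢ a≤b avoids)) (proj₂ (avoids-≢ a≤b avoids)))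

    gauge-system : ∀ k → IsDefiningSystem k e → IsDefiningSystem k g
    gauge-system k system p q 1≤p p≤q q≤k non-corner with index-cases p i | index-cases q i
    ... | inj₁ P.refl | inj₁ P.refl = eqn-transfer e g i i (∂ β) (C1.≡⇒≈ g-ii) tilde-ii eqn
      where eqn = system i i 1≤p p≤q q≤k non-corner
    ... | inj₁ P.refl | inj₂ q≢i = eqn-transfer e g i q _ (C1.≡⇒≈ (g-iq q q≢i))
          (tilde-row q i<q (system (suc i) q (s≤s z≤n) i<q q≤k (λ { (() , _) })))
          (system i q 1≤p p≤q q≤k non-corner)
      where i<q = ≤∧≢⇒< p≤q (q≢i ∘ P.sym)
    ... | inj₂ p≢i | inj₁ P.refl = eqn-transfer e g p i _ (C1.≡⇒≈ (g-pi p p≢i))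
          (tilde-col p p<i (system p i' 1≤p (≤-pred p<i) (≤-trans (n≤1+n i') q≤k)
            (λ { (_ , i'≡k) → <-irrefl i'≡k (<-≤-trans (n<1+n i') q≤k) })))
          (system p i 1≤p p≤q q≤k non-corner)
      where p<i = ≤∧≢⇒< p≤q p≢i
    ... | inj₂ p≢i | inj₂ q≢i with avoids? i p q
    ...   | inj₂ avoids = eqn-closed (Avoids i) (avoids-closed i) e g unchanged p q p≤q avoids
                            (system p q 1≤p p≤q q≤k non-corner)
    ...   | inj₁ (p≤i , i≤q) = eqn-same e g p q (C1.≡⇒≈ (g-pq p q p≢i q≢i))
              (tilde-across p q (≤∧≢⇒< p≤i p≢i) (≤∧≢⇒< i≤q (q≢i ∘ P.sym))) (system p q 1≤p p≤q q≤k non-corner)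

    -- c̃_{1k} changes by a coboundary: by tilde-row if i = 1, by tilde-col if
    -- i = k, and not at all otherwise.
    gauge-corner : ∀ k → 2 ≤ k → i ≤ k → IsDefiningSystem k e → SameClass (+ 1) (tilde g 1 k) (tilde e 1 k)
    gauge-corner k 2≤k i≤k system with index-cases i 1 | index-cases i k
    ... | inj₁ P.refl | _ = Cl1.same-trans
          (Cl1.same-≈ (tilde-row k 2≤k (system 2 k (s≤s z≤n) 2≤k ≤-refl (λ { (() , _) }))))
          (Cl1.same-+∂ (tilde e 1 k) _)
    ... | inj₂ i≢1 | inj₁ P.refl = Cl1.same-trans
          (Cl1.same-≈ (tilde-col 1 1<i (system 1 i' ≤-refl (≤-pred 1<i) (n≤1+n i')
            (λ { (_ , i'≡i) → <-irrefl i'≡i (n<1+n i') }))))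
          (Cl1.same-+∂ (tilde e 1 k) _)
      where 1<i = ≤∧≢⇒< (s≤s z≤n) (i≢1 ∘ P.sym)
    ... | inj₂ i≢1 | inj₂ i≢k = Cl1.same-≈ (tilde-across 1 k (≤∧≢⇒< (s≤s z≤n) (i≢1 ∘ P.sym)) (≤∧≢⇒< i≤k i≢k))

  -- Gauging the indices 1, …, j one after the other, a defining system e
  -- whose diagonal has the classes of that of d is replaced by one whose
  -- first j diagonal entries equal those of d, with c̃_{1k} in the same class.
  match-diagonal : ∀ k → 2 ≤ k → (d e : Family) → IsDefiningSystem k e → SameDiagonal k d e → ∀ j → j ≤ k →
    Σ Family λ e' → IsDefiningSystem k e' × SameClass (+ 1) (tilde e' 1 k) (tilde e 1 k) ×
                    SameDiagonal k d e' × (∀ p → 1 ≤ p → p ≤ j → e' p p C1.≈ d p p)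
  match-diagonal k 2≤k d e system same zero _ =
    e , system , Cl1.same-refl , same , λ p 1≤p p≤0 → ⊥-elim (<-irrefl P.refl (≤-trans 1≤p p≤0))
  match-diagonal k 2≤k d e system same (suc j) j<k
    with match-diagonal k 2≤k d e system same j (<⇒≤ j<k)
  ... | e₁ , system₁ , class₁ , same₁ , equal₁ =
        g , gauge-system k system₁ , Cl1.same-trans (gauge-corner k 2≤k j<k system₁) class₁ , same′ , equal′
    where
    -- d_ii - e₁_ii = ∂β at i = j+1; gauging by β makes the entries equal
    β = proj₁ (same₁ (suc j) (s≤s z≤n) j<k)
    open Gauge e₁ j β using (g; g-ii; g-pq; gauge-system; gauge-corner)
    equal-i : g (suc j) (suc j) C1.≈ d (suc j) (suc j)
    equal-i = C1.trans (C1.≡⇒≈ g-ii) (C1.trans (C1.∙-congˡ (proj₂ (same₁ (suc j) (s≤s z≤n) j<k))) (C1.add-sub _ _))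
    same′ : SameDiagonal k d g
    same′ p 1≤p p≤k with index-cases p (suc j)
    ... | inj₁ P.refl = Cl0.same-≈ (C1.sym equal-i)
    ... | inj₂ p≢i = P.subst (SameClass (+ 0) (d p p)) (P.sym (g-pq p p p≢i p≢i)) (same₁ p 1≤p p≤k)
    equal′ : ∀ p → 1 ≤ p → p ≤ suc j → g p p C1.≈ d p p
    equal′ p 1≤p p≤i with index-cases p (suc j)
    ... | inj₁ P.refl = equal-i
    ... | inj₂ p≢i = C1.trans (C1.≡⇒≈ (g-pq p p p≢i p≢i)) (equal₁ p 1≤p (≤-pred (≤∧≢⇒< p≤i p≢i)))

  Short : ℕ → ℕ → ℕ → ℕ → Set
  Short k L a b = 1 ≤ a × b ≤ k × b < a +ℕ L

  short-closed : ∀ k L → Closed (Short k L)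
  short-closed k L (1≤a , b≤k , b<a+L) a≤t t<b =
    (1≤a , ≤-trans (<⇒≤ t<b) b≤k , <-trans t<b b<a+L) ,
    (s≤s z≤n , b≤k , <-≤-trans b<a+L (+-monoˡ-≤ L (≤-trans a≤t (n≤1+n _))))

  non-corner⇒short : ∀ {L u v} → 1 ≤ u → v ≤ suc L → ¬ (u ≡ 1 × v ≡ suc L) → v < u +ℕ L
  non-corner⇒short {L} {u} 1≤u v≤ non-corner with index-cases u 1
  ... | inj₁ P.refl = ≤∧≢⇒< v≤ (λ v≡ → non-corner (P.refl , v≡))
  ... | inj₂ u≢1 = ≤-trans (s≤s v≤) (+-monoˡ-≤ L (≤∧≢⇒< 1≤u (u≢1 ∘ P.sym)))

  ShortEqns : ℕ → ℕ → Family → Set ℓm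
  ShortEqns K L g = ∀ a b → a ≤ b → Short K L a b → Eqn g a b

  -- If all equations of length < L hold, then c̃ at a position of length
  -- L ≥ 1 is a coboundary, provided Massey products of size L+1 are unique
  -- and contain 0: the window of g at that position is a defining system of
  -- size L+1, whose corner is that position.
  window-exact : ∀ K L (g : Family) → 1 ≤ L → Unique (suc L) → Solvable (suc L) → ShortEqns K L g →
                 ∀ a → 1 ≤ a → a +ℕ L ≤ K → Σ C¹ (λ x → ∂ x C2.≈ tilde g a (a +ℕ L))
  window-exact K L g 1≤L unique solvable eqns (suc s) _ a+L≤K =
    proj₁ solution , C2.trans (proj₂ solution)
                       (C2.≡⇒≈ (P.trans (tilde-shift g s 1 (suc L)) (P.cong (tilde g (suc s)) corner)))
    where
    window : Family
    window u v = g (u +ℕ s) (v +ℕ s)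
    corner : suc L +ℕ s ≡ suc s +ℕ L
    corner = P.cong suc (+-comm L s)
    system : IsDefiningSystem (suc L) window
    system u v 1≤u u≤v v≤L+1 non-corner = P.subst (C2._≈ ∂ (window u v)) (P.sym (tilde-shift g s u v))
      (eqns (u +ℕ s) (v +ℕ s) (+-monoˡ-≤ s u≤v)
        ( ≤-trans 1≤u (m≤m+n u s)
        , ≤-trans (+-monoˡ-≤ s v≤L+1) (P.subst (_≤ K) (P.sym corner) a+L≤K)
        , P.subst (v +ℕ s <_) (xy∙z≈xz∙y u L s) (+-monoˡ-< s (non-corner⇒short 1≤u v≤L+1 non-corner))))
    solution = corner-exact (suc L) (s≤s 1≤L) unique solvable window system

  -- A family f₀ which satisfies the defining
  -- equations of size K at all positions avoiding i and at (i, i) is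
  -- changed, superdiagonal by superdiagonal, at the positions (a, b) with
  -- a ≤ i ≤ b into a defining system of size K.  Each new entry is a
  -- primitive of c̃ provided by window-exact, so this uses that Massey
  -- products of all sizes < K are unique and contain 0.
  module Fill (K i : ℕ) (f₀ : Family)
      (unique : ∀ k → k < K → Unique k) (solvable : ∀ k → k < K → Solvable k)
      (eqn-avoiding : ∀ a b → 1 ≤ a → a ≤ b → b ≤ K → Avoids i a b → Eqn f₀ a b)
      (eqn-ii : Eqn f₀ i i) where

    Filled : ℕ → Family → Set ℓm
    Filled L g = (∀ a b → a ≤ b → Avoids i a b → g a b C1.≈ f₀ a b) × g i i C1.≈ f₀ i i × ShortEqns K L g

    base : Filled 1 f₀
    base = (λ _ _ _ _ → C1.refl) , C1.refl , diagonal
      where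
      diagonal : ShortEqns K 1 f₀
      diagonal a b a≤b (1≤a , b≤K , b<a+1) with ≤-antisym a≤b (≤-pred (P.subst (b <_) (+-comm a 1) b<a+1))
      ... | P.refl with avoids? i a a
      ...   | inj₁ (a≤i , i≤a) = P.subst (λ c → Eqn f₀ c c) (≤-antisym i≤a a≤i) eqn-ii
      ...   | inj₂ avoids      = eqn-avoiding a a 1≤a ≤-refl b≤K avoids

    module Raise (L : ℕ) (1≤L : 1 ≤ L) (L<K : suc L < K) (g : Family) (filled : Filled L g) where
      Target : ℕ → ℕ → Set
      Target a b = (a ≤ i × i ≤ b) × b ≡ a +ℕ L × 1 ≤ a × b ≤ K

      target? : ∀ a b → Dec (Target a b)
      target? a b = ((a ≤? i) ×-dec (i ≤? b)) ×-dec ((b ≟ a +ℕ L) ×-dec ((1 ≤? a) ×-dec (b ≤? K)))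

      -- there c̃(g) is a coboundary, all shorter equations being satisfied
      exact : ∀ a b → Target a b → Σ C¹ (λ x → ∂ x C2.≈ tilde g a b)
      exact a b (_ , P.refl , 1≤a , b≤K) =
        window-exact K L g 1≤L (unique (suc L) L<K) (solvable (suc L) L<K) (proj₂ (proj₂ filled)) a 1≤a b≤K

      g′ : Family
      g′ a b with target? a b
      ... | yes target = proj₁ (exact a b target)
      ... | no  _      = g a b

      g′-target : ∀ a b → Target a b → ∂ (g′ a b) C2.≈ tilde g a b
      g′-target a b target with target? a b
      ... | yes target′ = proj₂ (exact a b target′)
      ... | no  ¬target = ⊥-elim (¬target target)

      g′-other : ∀ a b → ¬ Target a b → g′ a b C1.≈ g a b
      g′-other a b ¬target with target? a b
      ... | yes target = ⊥-elim (¬target target)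
      ... | no  _      = C1.refl

      short-other : ∀ a b → b < a +ℕ L → ¬ Target a b
      short-other a b b<a+L (_ , b≡a+L , _) = <-irrefl b≡a+L b<a+L

      avoiding-other : ∀ a b → Avoids i a b → ¬ Target a b
      avoiding-other a b (inj₁ b<i) ((_ , i≤b) , _) = <-irrefl P.refl (<-≤-trans b<i i≤b)
      avoiding-other a b (inj₂ i<a) ((a≤i , _) , _) = <-irrefl P.refl (<-≤-trans i<a a≤i)

      g′-avoiding : ∀ a b → a ≤ b → Avoids i a b → g′ a b C1.≈ f₀ a b
      g′-avoiding a b a≤b avoids = C1.trans (g′-other a b (avoiding-other a b avoids)) (proj₁ filled a b a≤b avoids)

      g′-short : ∀ a b → a ≤ b → Short K L a b → g′ a b C1.≈ g a b
      g′-short a b _ (_ , _ , b<a+L) = g′-other a b (short-other a b b<a+L)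

      -- at length exactly L, c̃ only involves shorter, unchanged entries
      tilde-length-L : ∀ a → tilde g′ a (a +ℕ L) C2.≈ tilde g a (a +ℕ L)
      tilde-length-L a = tilde-cong g′ g a (a +ℕ L) (λ t a≤t t<b →
        g′-other a t (short-other a t t<b) ,
        g′-other (suc t) (a +ℕ L) (short-other (suc t) (a +ℕ L) (+-monoˡ-< L (s≤s a≤t))))

      filled′ : Filled (suc L) g′
      filled′ = g′-avoiding , C1.trans (g′-other i i (short-other i i (m<m+n i 1≤L))) (proj₁ (proj₂ filled)) , eqns
        where
        eqns : ShortEqns K (suc L) g′
        eqns a b a≤b (1≤a , b≤K , b<a+L+1) with m<1+n⇒m<n∨m≡n (P.subst (b <_) (+-suc a L) b<a+L+1)
        ... | inj₁ b<a+L = eqn-closed (Short K L) (short-closed K L) g g′ g′-short a b a≤b (1≤a , b≤K , b<a+L)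
                             (proj₂ (proj₂ filled) a b a≤b (1≤a , b≤K , b<a+L))
        ... | inj₂ P.refl with avoids? i a b
        ...   | inj₁ crossing = C2.trans (tilde-length-L a) (C2.sym (g′-target a b (crossing , P.refl , 1≤a , b≤K)))
        ...   | inj₂ avoids   = eqn-closed (Avoids i) (avoids-closed i) f₀ g′ g′-avoiding a b a≤b avoids
                                  (eqn-avoiding a b 1≤a a≤b b≤K avoids)

    fill : ∀ L → 1 ≤ L → L < K → Σ Family (Filled L)
    fill (suc zero)    _ _   = f₀ , base
    fill (suc (suc L)) _ L<K with fill (suc L) (s≤s z≤n) (<-trans (n<1+n (suc L)) L<K)
    ... | g , filled = Raise.g′ (suc L) (s≤s z≤n) L<K g filled ,
                       Raise.filled′ (suc L) (s≤s z≤n) L<K g filled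

    filled-system : ∀ K' → K ≡ suc K' → 1 ≤ K' → Σ Family λ f →
      (∀ a b → a ≤ b → Avoids i a b → f a b C1.≈ f₀ a b) × f i i C1.≈ f₀ i i × IsDefiningSystem K f
    filled-system K' P.refl 1≤K' with fill K' 1≤K' ≤-refl
    ... | f , avoiding , ii , eqns = f , avoiding , ii ,
          λ a b 1≤a a≤b b≤K non-corner → eqns a b a≤b (1≤a , b≤K , non-corner⇒short 1≤a b≤K non-corner)

  Agree : ℕ → ℕ → Family → Family → Set ℓm
  Agree k L d e = ∀ a b → a ≤ b → Short k L a b → d a b C1.≈ e a b

  tilde-agree : ∀ k L (d e : Family) → Agree k L d e → ∀ p q → 1 ≤ p → q ≤ k → q ≤ p +ℕ L → tilde d p q C2.≈ tilde e p q
  tilde-agree k L d e agree p q 1≤p q≤k q≤p+L = tilde-cong d e p q (λ t p≤t t<q →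
    agree p t p≤t (1≤p , ≤-trans (<⇒≤ t<q) q≤k , <-≤-trans t<q q≤p+L) ,
    agree (suc t) q t<q (s≤s z≤n , q≤k , ≤-<-trans q≤p+L (+-monoˡ-< L (s≤s p≤t))))

  Outside : ℕ → ℕ → ℕ → ℕ → Set
  Outside i j a b = ¬ (a ≤ i × j ≤ b)

  outside-closed : ∀ i j → Closed (Outside i j)
  outside-closed i j outside a≤t t<b =
    (λ { (a≤i , j≤t) → outside (a≤i , ≤-trans j≤t (<⇒≤ t<b)) }) ,
    (λ { (t<i , j≤b) → outside (≤-trans a≤t (≤-trans (n≤1+n _) t<i) , j≤b) })

  -- Let d, e be defining systems of size k which agree at
  -- all positions of length < ℓ, and let (i, j), j = i + ℓ, be a
  -- non-corner position.  Then z = d_ij - e_ij is a cocycle, and e is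
  -- changed into a defining system e′ with e′_ij = d_ij, which agrees with
  -- e outside the rectangle {a ≤ i, j ≤ b} and has c̃_{1k} in the same class:
  --   e′_ab = e_ab + f_{a,b-ℓ}   on the rectangle,
  -- where f is a defining system of size K = k - ℓ obtained by filling the
  -- cross of i in the family f₀ which is e above i, e shifted by ℓ below i,
  -- and z on the cross.  Then c̃ changes by c̃(f) on the rectangle, and at
  -- the corner c̃_{1K}(f) is a coboundary since K < k.
  module Move (k ℓ i : ℕ) (unique : ∀ k' → k' < k → Unique k') (solvable : ∀ k' → k' < k → Solvable k')
      (d e : Family) (d-system : IsDefiningSystem k d) (e-system : IsDefiningSystem k e)
      (1≤ℓ : 1 ≤ ℓ) (1≤i : 1 ≤ i) (j≤k : i +ℕ ℓ ≤ k) (non-corner : ¬ (i ≡ 1 × i +ℕ ℓ ≡ k))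
      (agree : Agree k ℓ d e) where

    j : ℕ
    j = i +ℕ ℓ

    i≤j : i ≤ j
    i≤j = m≤m+n i ℓ

    K : ℕ
    K = k ∸ ℓ

    K+ℓ≡k : K +ℕ ℓ ≡ k
    K+ℓ≡k = m∸n+n≡m (≤-trans (m≤n+m ℓ i) j≤k)

    K<k : K < k
    K<k = P.subst (K <_) K+ℓ≡k (P.subst (_≤ K +ℕ ℓ) (+-comm K 1) (+-monoʳ-≤ K 1≤ℓ))

    unshift : ∀ b → j ≤ b → (b ∸ ℓ) +ℕ ℓ ≡ b
    unshift b j≤b = m∸n+n≡m (≤-trans (m≤n+m ℓ i) j≤b)

    i≤unshift : ∀ b → j ≤ b → i ≤ b ∸ ℓ
    i≤unshift b j≤b = P.subst (_≤ b ∸ ℓ) (m+n∸n≡m i ℓ) (∸-monoˡ-≤ ℓ j≤b)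

    2≤K : 2 ≤ K
    2≤K = P.subst (_≤ K) (m+n∸n≡m 2 ℓ) (∸-monoˡ-≤ ℓ 2+ℓ≤k)
      where
      2+ℓ≤k : 2 +ℕ ℓ ≤ k
      2+ℓ≤k with index-cases i 1
      ... | inj₁ P.refl = ≤∧≢⇒< j≤k (λ j≡k → non-corner (P.refl , j≡k))
      ... | inj₂ i≢1    = ≤-trans (+-monoˡ-≤ ℓ (≤∧≢⇒< 1≤i (i≢1 ∘ P.sym))) j≤k

    i≤K : i ≤ K
    i≤K = i≤unshift k j≤k

    z : C¹
    z = d i j C1.+ C1.- (e i j)

    -- ∂z = c̃_{ij}(d) - c̃_{ij}(e) = 0, as c̃_{ij} only involves shorter entries
    z-cocycle : ∂ z C2.≈ C2.0#
    z-cocycle = begin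
      ∂ (d i j C1.+ C1.- (e i j))   ≈⟨ ∂-+ _ _ ⟩
      ∂ (d i j) + ∂ (C1.- (e i j))  ≈⟨ ∙-cong (sym (d-system i j 1≤i i≤j j≤k non-corner))
                                              (trans (∂-additive.f-neg _) (⁻¹-cong (sym (e-system i j 1≤i i≤j j≤k non-corner)))) ⟩
      tilde d i j + - tilde e i j   ≈⟨ ∙-congʳ (tilde-agree k ℓ d e agree i j 1≤i j≤k ≤-refl) ⟩
      tilde e i j + - tilde e i j   ≈⟨ inverseʳ _ ⟩
      0#                            ∎
      where open C2

    e↓ : Family
    e↓ a b = e (a +ℕ ℓ) (b +ℕ ℓ)

    f₀ : Family
    f₀ a b with b <? i | i <? a
    ... | yes _ | _     = e a b
    ... | no  _ | yes _ = e↓ a b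
    ... | no  _ | no  _ = z

    f₀-above : ∀ a b → b < i → f₀ a b ≡ e a b
    f₀-above a b b<i with b <? i
    ... | yes _   = P.refl
    ... | no  b≮i = ⊥-elim (b≮i b<i)

    f₀-below : ∀ a b → a ≤ b → i < a → f₀ a b ≡ e↓ a b
    f₀-below a b a≤b i<a with b <? i | i <? a
    ... | yes b<i | _       = ⊥-elim (<-irrefl P.refl (<-trans b<i (<-≤-trans i<a a≤b)))
    ... | no  _   | yes _   = P.refl
    ... | no  _   | no  i≮a = ⊥-elim (i≮a i<a)

    f₀-cross : ∀ a b → a ≤ i → i ≤ b → f₀ a b ≡ z
    f₀-cross a b a≤i i≤b with b <? i | i <? a
    ... | yes b<i | _       = ⊥-elim (<-irrefl P.refl (<-≤-trans b<i i≤b))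
    ... | no  _   | yes i<a = ⊥-elim (<-irrefl P.refl (<-≤-trans i<a a≤i))
    ... | no  _   | no  _   = P.refl

    -- f₀ satisfies the equations of size K away from the cross of i, being
    -- e resp. the shifted e there, and at (i, i) since z is a cocycle.
    f₀-avoiding : ∀ a b → 1 ≤ a → a ≤ b → b ≤ K → Avoids i a b → Eqn f₀ a b
    f₀-avoiding a b 1≤a a≤b b≤K (inj₁ b<i) =
      eqn-closed (λ _ b' → b' < i) (λ b<i _ t<b → <-trans t<b b<i , b<i)
        e f₀ (λ a' b' _ b'<i → C1.≡⇒≈ (f₀-above a' b' b'<i))
        a b a≤b b<i (e-system a b 1≤a a≤b (≤-trans b≤K (<⇒≤ K<k))
          λ { (_ , b≡k) → <-irrefl b≡k (<-≤-trans b<i (≤-trans i≤K (<⇒≤ K<k))) })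
    f₀-avoiding a b 1≤a a≤b b≤K (inj₂ i<a) =
      eqn-closed (λ a' _ → i < a') (λ i<a a≤t _ → i<a , <-≤-trans i<a (≤-trans a≤t (n≤1+n _)))
        e↓ f₀ (λ a' b' a'≤b' i<a' → C1.≡⇒≈ (f₀-below a' b' a'≤b' i<a'))
        a b a≤b i<a (P.subst (C2._≈ ∂ (e↓ a b)) (P.sym (tilde-shift e ℓ a b)) shifted)
      where
      shifted : Eqn e (a +ℕ ℓ) (b +ℕ ℓ)
      shifted = e-system (a +ℕ ℓ) (b +ℕ ℓ) (≤-trans 1≤a (m≤m+n a ℓ)) (+-monoˡ-≤ ℓ a≤b)
                  (P.subst (b +ℕ ℓ ≤_) K+ℓ≡k (+-monoˡ-≤ ℓ b≤K))
                  (λ { (a+ℓ≡1 , _) → <-irrefl (P.sym a+ℓ≡1) (<-≤-trans (≤-<-trans 1≤i i<a) (m≤m+n a ℓ)) })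

    f₀-ii : Eqn f₀ i i
    f₀-ii = C2.trans (tilde-diag f₀ i) (C2.sym (C2.trans (∂-cong (C1.≡⇒≈ (f₀-cross i i ≤-refl ≤-refl))) z-cocycle))

    module F = Fill K i f₀ (λ k' k'<K → unique k' (<-trans k'<K K<k)) (λ k' k'<K → solvable k' (<-trans k'<K K<k))
                 f₀-avoiding f₀-ii

    filled = F.filled-system (K ∸ 1) (+-∸-assoc 1 (≤-trans (n≤1+n 1) 2≤K)) (∸-monoˡ-≤ 1 2≤K)

    f : Family
    f = proj₁ filled

    f-avoiding : ∀ a b → a ≤ b → Avoids i a b → f a b C1.≈ f₀ a b
    f-avoiding = proj₁ (proj₂ filled)

    f-system : IsDefiningSystem K f
    f-system = proj₂ (proj₂ (proj₂ filled))

    f-ii : f i i C1.≈ z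
    f-ii = C1.trans (proj₁ (proj₂ (proj₂ filled))) (C1.≡⇒≈ (f₀-cross i i ≤-refl ≤-refl))

    e′ : Family
    e′ a b with (a ≤? i) ×-dec (j ≤? b)
    ... | yes _ = e a b C1.+ f a (b ∸ ℓ)
    ... | no  _ = e a b

    e′-inside : ∀ a b → a ≤ i → j ≤ b → e′ a b ≡ e a b C1.+ f a (b ∸ ℓ)
    e′-inside a b a≤i j≤b with (a ≤? i) ×-dec (j ≤? b)
    ... | yes _    = P.refl
    ... | no  ¬rect = ⊥-elim (¬rect (a≤i , j≤b))

    e′-outside : ∀ a b → Outside i j a b → e′ a b ≡ e a b
    e′-outside a b outside with (a ≤? i) ×-dec (j ≤? b)
    ... | yes rect = ⊥-elim (outside rect)
    ... | no  _    = P.refl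

    -- The summands by which c̃(e′)_{ab} exceeds c̃(e)_{ab} on the rectangle:
    -- e_at f_{t+1,b-ℓ} for t < i, and f_{a,t-ℓ} e_{t+1,b} for t ≥ j.
    left right : ℕ → ℕ → ℕ → C²
    left  a b t = e a t · f (suc t) (b ∸ ℓ)
    right a b t = f a (t ∸ ℓ) · e (suc t) b

    -- Splitting the sum at i and j: before i only the second factor lies in
    -- the rectangle, after j only the first, in between neither.
    sum-e′ : ∀ a b → a ≤ i → j ≤ b →
             C2.∑ a b (λ t → e′ a t · e′ (suc t) b) C2.≈
             C2.∑ a b (λ t → e a t · e (suc t) b) C2.+ (C2.∑ a i (left a b) C2.+ C2.∑ j b (right a b))
    sum-e′ a b a≤i j≤b = begin
      ∑ a b term′                                       ≈⟨ ∑-split₃ a i j b term′ a≤i i≤j j≤b ⟩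
      ∑ a i term′ + (∑ i j term′ + ∑ j b term′)         ≈⟨ ∙-cong (trans (∑-cong a i before-i) (∑-+ a i _ _))
                                                             (∙-cong (∑-cong i j between) (trans (∑-cong j b after-j) (∑-+ j b _ _))) ⟩
      (∑ a i term + ∑ a i (left a b)) + (∑ i j term + (∑ j b term + ∑ j b (right a b)))
                                                        ≈⟨ interchange₃ _ _ _ _ _ ⟩
      (∑ a i term + (∑ i j term + ∑ j b term)) + (∑ a i (left a b) + ∑ j b (right a b))
                                                        ≈⟨ ∙-congʳ (sym (∑-split₃ a i j b term a≤i i≤j j≤b)) ⟩
      ∑ a b term + (∑ a i (left a b) + ∑ j b (right a b)) ∎
      where
      open C2
      term′ term : ℕ → C²
      term′ t = e′ a t · e′ (suc t) b
      term  t = e a t · e (suc t) b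
      outside-left : ∀ {t} → t < j → Outside i j a t
      outside-left t<j (_ , j≤t) = <-irrefl P.refl (<-≤-trans t<j j≤t)
      outside-right : ∀ {t} → i ≤ t → Outside i j (suc t) b
      outside-right i≤t (t<i , _) = <-irrefl P.refl (<-≤-trans t<i i≤t)
      before-i : ∀ t → a ≤ t → t < i → term′ t ≈ term t + left a b t
      before-i t _ t<i = trans (≡⇒≈ (P.cong₂ _·_ (e′-outside a t (outside-left (<-≤-trans t<i i≤j)))
                                                  (e′-inside (suc t) b t<i j≤b)))
                           (·-distribˡ _ _ _)
      between : ∀ t → i ≤ t → t < j → term′ t ≈ term t
      between t i≤t t<j = ≡⇒≈ (P.cong₂ _·_ (e′-outside a t (outside-left t<j)) (e′-outside (suc t) b (outside-right i≤t)))
      after-j : ∀ t → j ≤ t → t < b → term′ t ≈ term t + right a b t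
      after-j t j≤t _ = trans (≡⇒≈ (P.cong₂ _·_ (e′-inside a t a≤i j≤t)
                                                 (e′-outside (suc t) b (outside-right (≤-trans i≤j j≤t)))))
                          (·-distribʳ _ _ _)

    -- The extra summands are exactly those of c̃(f)_{a,b-ℓ}, split at i: f is
    -- e above i and shifted e below i, away from the cross.
    sum-f : ∀ a b → a ≤ i → j ≤ b →
            C2.∑ a (b ∸ ℓ) (λ s → f a s · f (suc s) (b ∸ ℓ)) C2.≈ C2.∑ a i (left a b) C2.+ C2.∑ j b (right a b)
    sum-f a b a≤i j≤b = begin
      ∑ a b′ fterm                                      ≈⟨ ∑-split a i b′ fterm a≤i (i≤unshift b j≤b) ⟩
      ∑ a i fterm + ∑ i b′ fterm                        ≈⟨ ∙-cong (∑-cong a i fterm-left) (∑-cong i b′ fterm-right) ⟩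
      ∑ a i (left a b) + ∑ i b′ (λ s → right a b (s +ℕ ℓ)) ≡⟨ P.cong (λ c → ∑ a i (left a b) + c) shift ⟩
      ∑ a i (left a b) + ∑ j b (right a b)              ∎
      where
      open C2
      b′ = b ∸ ℓ
      fterm : ℕ → C²
      fterm s = f a s · f (suc s) b′
      fterm-left : ∀ s → a ≤ s → s < i → fterm s ≈ left a b s
      fterm-left s a≤s s<i = ·-cong (C1.trans (f-avoiding a s a≤s (inj₁ s<i)) (C1.≡⇒≈ (f₀-above a s s<i))) C1.refl
      fterm-right : ∀ s → i ≤ s → s < b′ → fterm s ≈ right a b (s +ℕ ℓ)
      fterm-right s i≤s s<b′ = ·-cong (C1.≡⇒≈ (P.cong (f a) (P.sym (m+n∸n≡m s ℓ))))
        (C1.trans (f-avoiding (suc s) b′ s<b′ (inj₂ (s≤s i≤s)))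
          (C1.≡⇒≈ (P.trans (f₀-below (suc s) b′ s<b′ (s≤s i≤s)) (P.cong (e (suc s +ℕ ℓ)) (unshift b j≤b)))))
      shift : ∑ i b′ (λ s → right a b (s +ℕ ℓ)) ≡ ∑ j b (right a b)
      shift = P.trans (∑-shift i b′ ℓ (right a b)) (P.cong (λ c → ∑ j c (right a b)) (unshift b j≤b))

    tilde-rectangle : ∀ a b → a ≤ i → j ≤ b → tilde e′ a b C2.≈ tilde e a b C2.+ tilde f a (b ∸ ℓ)
    tilde-rectangle a b a≤i j≤b = begin
      - ∑ a b (λ t → e′ a t · e′ (suc t) b)                  ≈⟨ ⁻¹-cong (sum-e′ a b a≤i j≤b) ⟩
      - (∑ a b (λ t → e a t · e (suc t) b) + (∑ a i (left a b) + ∑ j b (right a b)))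
                                                             ≈⟨ neg-+ _ _ ⟩
      tilde e a b + - (∑ a i (left a b) + ∑ j b (right a b)) ≈⟨ ∙-congˡ (⁻¹-cong (sym (sum-f a b a≤i j≤b))) ⟩
      tilde e a b + tilde f a (b ∸ ℓ)                        ∎
      where open C2

    rectangle? : ∀ a b → (a ≤ i × j ≤ b) ⊎ Outside i j a b
    rectangle? a b with (a ≤? i) ×-dec (j ≤? b)
    ... | yes rect = inj₁ rect
    ... | no  out  = inj₂ out

    -- outside the rectangle nothing changes; inside, c̃ changes by c̃(f) = ∂f
    e′-system : IsDefiningSystem k e′
    e′-system p q 1≤p p≤q q≤k non-corner-pq with rectangle? p q
    ... | inj₂ outside = eqn-closed (Outside i j) (outside-closed i j) e e′
                           (λ a b _ out → C1.≡⇒≈ (e′-outside a b out)) p q p≤q outside (e-system p q 1≤p p≤q q≤k non-corner-pq)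
    ... | inj₁ (p≤i , j≤q) = eqn-transfer e e′ p q (f p (q ∸ ℓ)) (C1.≡⇒≈ (e′-inside p q p≤i j≤q))
          (C2.trans (tilde-rectangle p q p≤i j≤q) (C2.∙-congˡ f-eqn)) (e-system p q 1≤p p≤q q≤k non-corner-pq)
      where
      f-eqn : Eqn f p (q ∸ ℓ)
      f-eqn = f-system p (q ∸ ℓ) 1≤p (≤-trans p≤i (i≤unshift q j≤q)) (∸-monoˡ-≤ ℓ q≤k)
        (λ { (p≡1 , q-ℓ≡K) → non-corner-pq (p≡1 , P.trans (P.sym (unshift q j≤q)) (P.trans (P.cong (_+ℕ ℓ) q-ℓ≡K) K+ℓ≡k)) })

    -- the corner changes by c̃(f)_{1K}, a coboundary since K < k
    e′-corner : SameClass (+ 1) (tilde e′ 1 k) (tilde e 1 k)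
    e′-corner = Cl1.same-trans
      (Cl1.same-≈ (C2.trans (tilde-rectangle 1 k 1≤i j≤k) (C2.∙-congˡ (C2.sym (proj₂ exact)))))
      (Cl1.same-+∂ (tilde e 1 k) (proj₁ exact))
      where exact = corner-exact K 2≤K (unique K K<k) (solvable K K<k) f f-system

    -- e′_ij = e_ij + f_ii = e_ij + z = d_ij
    e′-ij : e′ i j C1.≈ d i j
    e′-ij = C1.trans (C1.≡⇒≈ (P.trans (e′-inside i j ≤-refl ≤-refl) (P.cong (λ c → e i j C1.+ f i c) (m+n∸n≡m i ℓ))))
              (C1.trans (C1.∙-congˡ f-ii) (C1.add-sub (e i j) (d i j)))

  -- Given a defining system d of size k, a
  -- defining system e whose c̃_{1k} has the class of that of e₀ and which
  -- agrees with d at the positions of length < ℓ is moved, row by row, to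
  -- agree with d also at the positions of length ℓ.  Each move changes e only
  -- on a rectangle, which contains neither shorter positions nor the
  -- positions of length ℓ in earlier rows.
  module Sweep (k : ℕ) (unique : ∀ k' → k' < k → Unique k') (solvable : ∀ k' → k' < k → Solvable k')
               (d : Family) (d-system : IsDefiningSystem k d) (e₀ : Family) where

    Invariant : ℕ → Family → Set (m ⊔ ℓm)
    Invariant ℓ e = IsDefiningSystem k e × SameClass (+ 1) (tilde e 1 k) (tilde e₀ 1 k) × Agree k ℓ d e

    RowsDone : ℕ → ℕ → Family → Set ℓm
    RowsDone ℓ r e = ∀ p → 1 ≤ p → p ≤ r → p +ℕ ℓ ≤ k → d p (p +ℕ ℓ) C1.≈ e p (p +ℕ ℓ)

    rows : ∀ ℓ → 1 ≤ ℓ → 2 +ℕ ℓ ≤ k → ∀ e → Invariant ℓ e →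
           ∀ r → Σ Family λ e′ → Invariant ℓ e′ × RowsDone ℓ r e′
    rows ℓ 1≤ℓ 2+ℓ≤k e invariant zero = e , invariant , λ p 1≤p p≤0 _ → ⊥-elim (<-irrefl P.refl (≤-trans 1≤p p≤0))
    rows ℓ 1≤ℓ 2+ℓ≤k e invariant (suc r) with rows ℓ 1≤ℓ 2+ℓ≤k e invariant r
    ... | e₁ , (system₁ , class₁ , agree₁) , done₁ with suc r +ℕ ℓ ≤? k
    ...   | no r+1+ℓ≰k = e₁ , (system₁ , class₁ , agree₁) , done
      where
      done : RowsDone ℓ (suc r) e₁
      done p 1≤p p≤r+1 p+ℓ≤k with index-cases p (suc r)
      ... | inj₁ P.refl = ⊥-elim (r+1+ℓ≰k p+ℓ≤k)
      ... | inj₂ p≢r+1 = done₁ p 1≤p (≤-pred (≤∧≢⇒< p≤r+1 p≢r+1)) p+ℓ≤k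
    ...   | yes r+1+ℓ≤k = M.e′ , (M.e′-system , Cl1.same-trans M.e′-corner class₁ , agree′) , done
      where
      non-corner : ¬ (suc r ≡ 1 × suc r +ℕ ℓ ≡ k)
      non-corner (P.refl , 1+ℓ≡k) = <-irrefl 1+ℓ≡k 2+ℓ≤k
      module M = Move k ℓ (suc r) unique solvable d e₁ d-system system₁ 1≤ℓ (s≤s z≤n) r+1+ℓ≤k non-corner agree₁
      -- positions of length < ℓ lie outside the rectangle
      agree′ : Agree k ℓ d M.e′
      agree′ a b a≤b short@(_ , _ , b<a+ℓ) = C1.trans (agree₁ a b a≤b short) (C1.≡⇒≈ (P.sym (M.e′-outside a b
        λ { (a≤r+1 , j≤b) → <-irrefl P.refl (<-≤-trans b<a+ℓ (≤-trans (+-monoˡ-≤ ℓ a≤r+1) j≤b)) })))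
      done : RowsDone ℓ (suc r) M.e′
      done p 1≤p p≤r+1 p+ℓ≤k with index-cases p (suc r)
      ... | inj₁ P.refl = C1.sym M.e′-ij
      ... | inj₂ p≢r+1 = C1.trans (done₁ p 1≤p p≤r p+ℓ≤k) (C1.≡⇒≈ (P.sym (M.e′-outside p (p +ℕ ℓ)
              λ { (_ , j≤p+ℓ) → <-irrefl P.refl (<-≤-trans (s≤s p≤r) (+-cancelʳ-≤ ℓ (suc r) p j≤p+ℓ)) })))
        where p≤r = ≤-pred (≤∧≢⇒< p≤r+1 p≢r+1)

    extend : ∀ ℓ e → Agree k ℓ d e → RowsDone ℓ k e → Agree k (suc ℓ) d e
    extend ℓ e agree done a b a≤b (1≤a , b≤k , b<a+ℓ+1) with m<1+n⇒m<n∨m≡n (P.subst (b <_) (+-suc a ℓ) b<a+ℓ+1)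
    ... | inj₁ b<a+ℓ = agree a b a≤b (1≤a , b≤k , b<a+ℓ)
    ... | inj₂ P.refl = done a 1≤a (≤-trans a≤b b≤k) b≤k

    lengths : ∀ L → 1 ≤ L → L < k → ∀ e → Invariant 1 e → Σ Family (Invariant L)
    lengths (suc zero)    _ _   e invariant = e , invariant
    lengths (suc (suc L)) _ L<k e invariant with lengths (suc L) (s≤s z≤n) (<-trans (n<1+n (suc L)) L<k) e invariant
    ... | e₁ , invariant₁ with rows (suc L) (s≤s z≤n) L<k e₁ invariant₁ k
    ...   | e₂ , (system₂ , class₂ , agree₂) , done₂ = e₂ , system₂ , class₂ , extend (suc L) e₂ agree₂ done₂

  -- Uniqueness for size k from uniqueness and solvability for all smaller
  -- sizes: match the diagonal of d′ with that of d, then sweep the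
  -- superdiagonals of length 1, …, k-2; the result agrees with d at all
  -- entries entering c̃_{1k}.
  uniqueness-step : ∀ k → (∀ k' → k' < k → Unique k') → (∀ k' → k' < k → Solvable k') → Unique k
  uniqueness-step zero          _      _        d d′ _ _ _ = Cl1.same-refl
  uniqueness-step (suc zero)    _      _        d d′ _ _ _ = Cl1.same-refl
  uniqueness-step k@(suc (suc k₂)) unique solvable d d′ d-system d′-system same
    with match-diagonal k (s≤s (s≤s z≤n)) d d′ d′-system same k ≤-refl
  ... | e₁ , system₁ , class₁ , _ , equal₁
    with Sweep.lengths k unique solvable d d-system d′ (suc k₂) (s≤s z≤n) ≤-refl e₁ (system₁ , class₁ , agree₁)
    where
    agree₁ : Agree k 1 d e₁
    agree₁ a b a≤b (1≤a , b≤k , b<a+1) with ≤-antisym a≤b (≤-pred (P.subst (b <_) (+-comm a 1) b<a+1))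
    ... | P.refl = C1.sym (equal₁ a 1≤a b≤k)
  ... | e₂ , _ , class₂ , agree₂ =
    Cl1.same-trans (Cl1.same-≈ (tilde-agree k (suc k₂) d e₂ agree₂ 1 k ≤-refl ≤-refl ≤-refl)) class₂

  uniqueness : ∀ n → DefiningSystemsExist n → ∀ k → k ≤ n → Unique k
  uniqueness n exist = <-rec (λ k → k ≤ n → Unique k) step
    where
    step : ∀ k → (∀ {k'} → k' < k → k' ≤ n → Unique k') → k ≤ n → Unique k
    step k smaller k≤n = uniqueness-step k (λ k' k'<k → smaller k'<k (≤-trans (<⇒≤ k'<k) k≤n))
                                           (λ k' k'<k → solvable-below n exist k' (<-≤-trans k'<k k≤n))

-- Proposition 3.3.
proposition3p3 : ∀ {r ℓr m ℓm} (R : CommutativeRing r ℓr) (A : DGA R m ℓm) (n : ℕ) → 2 ≤ n →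
    let open DGA A
        open DGANotions A
    in
    (∀ (c : ℕ → C¹) → (∀ i → 1 ≤ i → i ≤ n → IsCocycle (+ 1) (c i)) →
      Σ (ℕ → ℕ → C¹) (λ d → IsDefiningSystem n d × (∀ i → 1 ≤ i → i ≤ n → d i i ≈[ + 1 ] c i))) →
    ∀ (d d' : ℕ → ℕ → C¹) → IsDefiningSystem n d → IsDefiningSystem n d' →
    (∀ i → 1 ≤ i → i ≤ n → SameClass (+ 0) (d i i) (d' i i)) →
    SameClass (+ 1) (tilde d 1 n) (tilde d' 1 n)
proposition3p3 R A n _ exist = Massey.uniqueness A n exist n ≤-refl
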